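{- Let $G$ be a connected stepwise irregular graph. Then the line graph $L(G)$ is not stepwise irregular.
   Context: All graphs are finite and simple. A graph $G$ is stepwise irregular (SI) if for every edge $uv\in E(G)$ one has $|d_G(u)-d_G(v)|=1$, where $d_G$ denotes degree. The line graph $L(G)$ has vertex set $E(G)$, two vertices of $L(G)$ being adjacent iff the corresponding edges of $G$ share an endpoint. -}

module Defs where

open import Data.Nat.Base using (ℕ; zero; suc; ∣_-_∣; _<ᵇ_)
open import Data.Bool.Base using (Bool; true; false; _∧_; _∨_; not; if_then_else_)
open import Data.Fin.Base using (Fin; toℕ)
open import Data.Fin.Properties using () renaming (_≟_ to _≟ᶠ_)

open import Data.List.Base using (List; []; _∷_; length; filterᵇ; concatMap; map; lookup; allFin)
open import Data.Product.Base using (_×_; _,_; proj₁; proj₂; Σ; ∃)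
open import Relation.Nullary.Decidable.Core using (does)
open import Relation.Binary.PropositionalEquality using (_≡_)

Adjacency : ℕ → Set
Adjacency n = Fin n → Fin n → Bool

record IsSimple {n : ℕ} (adj : Adjacency n) : Set where
  field
    symmetric   : ∀ u v → adj u v ≡ adj v u
    irreflexive : ∀ u → adj u u ≡ false

degree : ∀ {n} → Adjacency n → Fin n → ℕ
degree {n} adj u = length (filterᵇ (adj u) (allFin n))

StepwiseIrregular : ∀ {n} → Adjacency n → Set
StepwiseIrregular {n} adj = ∀ u v → adj u v ≡ true → ∣ degree adj u - degree adj v ∣ ≡ 1

data Walk {n : ℕ} (adj : Adjacency n) : Fin n → Fin n → Set where
  here : ∀ {u} → Walk adj u u
  step : ∀ {u v w} → adj u v ≡ true → Walk adj v w → Walk adj u w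

Connected : ∀ {n} → Adjacency n → Set
Connected {n} adj = ∀ u v → Walk adj u v

-- the edge set: each edge {u,v} listed exactly once as the pair (u , v) with u < v
edges : ∀ {n} → Adjacency n → List (Fin n × Fin n)
edges {n} adj =
  filterᵇ (λ p → (toℕ (proj₁ p) <ᵇ toℕ (proj₂ p)) ∧ adj (proj₁ p) (proj₂ p))
          (concatMap (λ u → map (λ v → (u , v)) (allFin n)) (allFin n))

_==_ : ∀ {n} → Fin n → Fin n → Bool
a == b = does (a ≟ᶠ b)

shareEndpoint : ∀ {n} → (Fin n × Fin n) → (Fin n × Fin n) → Bool
shareEndpoint (a , b) (c , d) = (a == c) ∨ (a == d) ∨ (b == c) ∨ (b == d)

-- line graph: vertex set = edges of G (indexed by Fin (lineSize adj)),
-- two distinct edges adjacent iff they share an endpoint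
lineSize : ∀ {n} → Adjacency n → ℕ
lineSize adj = length (edges adj)

lineGraph : ∀ {n} (adj : Adjacency n) → Adjacency (lineSize adj)
lineGraph adj i j =
  not (i == j) ∧ shareEndpoint (lookup (edges adj) i) (lookup (edges adj) j)

HasEdge : ∀ {n} → Adjacency n → Set
HasEdge {n} adj = Σ (Fin n) λ u → Σ (Fin n) λ v → adj u v ≡ true

module Submission where

-- An edge e = ab of G is adjacent in L(G) to exactly the other edges through
-- a or through b, so  2 + d_L(e) = d(a) + d(b).  In a stepwise irregular G
-- the degrees d(a), d(b) differ by one, so their sum is odd: every vertex of
-- L(G) has odd degree.  On the other hand the two ends of an edge of a
-- stepwise irregular graph have degrees of opposite parity, so a graph with a
-- vertex and only odd degrees is never stepwise irregular (an odd-degree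
-- vertex has a neighbour, whose degree is odd as well).

open import Defs
open import Data.Nat.Base using (ℕ; zero; suc; _+_; _*_; _≤_; _<_; z<s; _<ᵇ_; ∣_-_∣)
open import Data.Nat.Properties
  using (+-*-semiring; _<?_; <ᵇ⇒<; <-cmp; <-irrefl; <-asym; m≤m+n; m≤n+m; ≤-trans;
         +-identityʳ; +-assoc; *-identityʳ; *-zeroʳ; *-assoc; *-distribʳ-+; module ≤-Reasoning)
open import Data.Bool.Base using (Bool; true; false; _∧_; _∨_; not; _xor_; T)
open import Data.Bool.Properties
  using (∧-conicalˡ; ∧-conicalʳ; ∨-assoc; ∨-zeroʳ; not-involutive; not-distribˡ-xor; xor-same; not-¬)
open import Data.Unit.Base using (tt)
open import Data.Fin.Base using (Fin; toℕ; zero; suc; fromℕ<)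
open import Data.Fin.Properties using (toℕ-injective) renaming (_≟_ to _≟ᶠ_)
open import Data.List.Base using (List; []; _∷_; _++_; length; filterᵇ; concatMap; map; lookup; tabulate; allFin)
open import Data.Product.Base using (_×_; _,_; proj₁; proj₂; Σ)
open import Data.Sum.Base using (_⊎_; inj₁; inj₂)
open import Data.Empty using (⊥-elim)
open import Relation.Nullary using (¬_; yes; no)
open import Relation.Nullary.Decidable using (dec-true; dec-false)
open import Relation.Binary.Definitions using (tri<; tri≈; tri>)
open import Relation.Binary.PropositionalEquality
open import Algebra.Properties.Semiring.Sum +-*-semiring
  using (sum; sum-syntax; sum-cong-≗; ∑-distrib-+; *-distribˡ-sum; sum-replicate-zero)

⟦_⟧ : Bool → ℕ
⟦ true ⟧  = 1
⟦ false ⟧ = 0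

⟦∧⟧ : ∀ p q → ⟦ p ∧ q ⟧ ≡ ⟦ p ⟧ * ⟦ q ⟧
⟦∧⟧ true  true  = refl
⟦∧⟧ true  false = refl
⟦∧⟧ false q     = refl

⟦∧⟧+⟦∨⟧ : ∀ p q → ⟦ p ∧ q ⟧ + ⟦ p ∨ q ⟧ ≡ ⟦ p ⟧ + ⟦ q ⟧
⟦∧⟧+⟦∨⟧ true  true  = refl
⟦∧⟧+⟦∨⟧ true  false = refl
⟦∧⟧+⟦∨⟧ false q     = refl

⟦⟧-false : ∀ {p} → ¬ (p ≡ true) → ⟦ p ⟧ ≡ 0
⟦⟧-false {false} _ = refl
⟦⟧-false {true}  p≢true = ⊥-elim (p≢true refl)

bool-ext : ∀ {p q} → (p ≡ true → q ≡ true) → (q ≡ true → p ≡ true) → p ≡ q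
bool-ext {false} {false} _ _ = refl
bool-ext {false} {true}  _ q⇒p = q⇒p refl
bool-ext {true}  {q}     p⇒q _ = sym (p⇒q refl)

==-refl : ∀ {n} (a : Fin n) → (a == a) ≡ true
==-refl a = dec-true (a ≟ᶠ a) refl

==-sound : ∀ {n} {a b : Fin n} → (a == b) ≡ true → a ≡ b
==-sound {a = a} {b} a==b with a ≟ᶠ b
... | yes a≡b = a≡b

==-∨ : ∀ {n} {a x y : Fin n} → (a == x ∨ a == y) ≡ true → a ≡ x ⊎ a ≡ y
==-∨ {a = a} {x} a∈xy with a ≟ᶠ x
... | yes a≡x = inj₁ a≡x
... | no _    = inj₂ (==-sound a∈xy)

<ᵇ-true : ∀ {m n} → m < n → (m <ᵇ n) ≡ true
<ᵇ-true {m} {n} = dec-true (m <? n)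

<ᵇ-false : ∀ {m n} → ¬ m < n → (m <ᵇ n) ≡ false
<ᵇ-false {m} {n} = dec-false (m <? n)

<ᵇ-sound : ∀ {m n} → (m <ᵇ n) ≡ true → m < n
<ᵇ-sound {m} {n} m<ᵇn = <ᵇ⇒< m n (subst T (sym m<ᵇn) tt)

∑-pick : ∀ n (a : Fin n) (f : Fin n → ℕ) → ∑[ i < n ] (⟦ a == i ⟧ * f i) ≡ f a
∑-pick (suc n) zero    f = trans (cong₂ _+_ (+-identityʳ (f zero)) (sum-replicate-zero n)) (+-identityʳ (f zero))
∑-pick (suc n) (suc a) f = ∑-pick n a (λ i → f (suc i))

∑∑-pick : ∀ n m (a : Fin n) (f : Fin n → Fin m → ℕ) →
  ∑[ x < n ] ∑[ y < m ] (⟦ a == x ⟧ * f x y) ≡ ∑[ y < m ] f a y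
∑∑-pick n m a f = begin
  ∑[ x < n ] ∑[ y < m ] (⟦ a == x ⟧ * f x y)  ≡⟨ sum-cong-≗ (λ x → sym (*-distribˡ-sum ⟦ a == x ⟧ (f x))) ⟩
  ∑[ x < n ] (⟦ a == x ⟧ * ∑[ y < m ] f x y)  ≡⟨ ∑-pick n a (λ x → ∑[ y < m ] f x y) ⟩
  ∑[ y < m ] f a y                            ∎
  where open ≡-Reasoning

term≤∑ : ∀ n (f : Fin n → ℕ) (a : Fin n) → f a ≤ sum f
term≤∑ (suc n) f zero    = m≤m+n (f zero) _
term≤∑ (suc n) f (suc a) = ≤-trans (term≤∑ n (λ i → f (suc i)) a) (m≤n+m _ (f zero))

listSum : ∀ {A : Set} → (A → ℕ) → List A → ℕ
listSum g []       = 0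
listSum g (x ∷ xs) = g x + listSum g xs

length-as-listSum : ∀ {A : Set} (xs : List A) → length xs ≡ listSum (λ _ → 1) xs
length-as-listSum []       = refl
length-as-listSum (x ∷ xs) = cong suc (length-as-listSum xs)

length-filterᵇ : ∀ {A : Set} (p : A → Bool) xs → length (filterᵇ p xs) ≡ listSum (λ x → ⟦ p x ⟧) xs
length-filterᵇ p []       = refl
length-filterᵇ p (x ∷ xs) with p x
... | true  = cong suc (length-filterᵇ p xs)
... | false = length-filterᵇ p xs

listSum-filterᵇ : ∀ {A : Set} (g : A → ℕ) (p : A → Bool) xs →
  listSum g (filterᵇ p xs) ≡ listSum (λ x → g x * ⟦ p x ⟧) xs
listSum-filterᵇ g p []       = refl
listSum-filterᵇ g p (x ∷ xs) with p x
... | true  = cong₂ _+_ (sym (*-identityʳ (g x))) (listSum-filterᵇ g p xs)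
... | false = trans (listSum-filterᵇ g p xs) (cong (_+ listSum (λ y → g y * ⟦ p y ⟧) xs) (sym (*-zeroʳ (g x))))

listSum-++ : ∀ {A : Set} (g : A → ℕ) xs ys → listSum g (xs ++ ys) ≡ listSum g xs + listSum g ys
listSum-++ g []       ys = refl
listSum-++ g (x ∷ xs) ys = trans (cong (g x +_) (listSum-++ g xs ys)) (sym (+-assoc (g x) _ _))

listSum-concatMap : ∀ {A B : Set} (g : B → ℕ) (f : A → List B) xs →
  listSum g (concatMap f xs) ≡ listSum (λ x → listSum g (f x)) xs
listSum-concatMap g f []       = refl
listSum-concatMap g f (x ∷ xs) =
  trans (listSum-++ g (f x) (concatMap f xs)) (cong (listSum g (f x) +_) (listSum-concatMap g f xs))

listSum-map : ∀ {A B : Set} (g : B → ℕ) (f : A → B) xs → listSum g (map f xs) ≡ listSum (λ x → g (f x)) xs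
listSum-map g f []       = refl
listSum-map g f (x ∷ xs) = cong (g (f x) +_) (listSum-map g f xs)

listSum-tabulate : ∀ {A : Set} n (g : A → ℕ) (f : Fin n → A) → listSum g (tabulate f) ≡ ∑[ i < n ] g (f i)
listSum-tabulate zero    g f = refl
listSum-tabulate (suc n) g f = cong (g (f zero) +_) (listSum-tabulate n g (λ i → f (suc i)))

listSum-lookup : ∀ {A : Set} (g : A → ℕ) (xs : List A) → ∑[ j < length xs ] g (lookup xs j) ≡ listSum g xs
listSum-lookup g []       = refl
listSum-lookup g (x ∷ xs) = cong (g x +_) (listSum-lookup g xs)

filterᵇ-lookup : ∀ {A : Set} (p : A → Bool) (xs : List A) (i : Fin (length (filterᵇ p xs))) →
  p (lookup (filterᵇ p xs) i) ≡ true
filterᵇ-lookup p []       ()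
filterᵇ-lookup p (x ∷ xs) i with p x in px
filterᵇ-lookup p (x ∷ xs) zero    | true  = px
filterᵇ-lookup p (x ∷ xs) (suc i) | true  = filterᵇ-lookup p xs i
... | false = filterᵇ-lookup p xs i

degree-as-sum : ∀ {n} (adj : Adjacency n) u → degree adj u ≡ ∑[ v < n ] ⟦ adj u v ⟧
degree-as-sum {n} adj u = trans (length-filterᵇ (adj u) (allFin n)) (listSum-tabulate n (λ v → ⟦ adj u v ⟧) (λ v → v))

-- The edge list of G lists each edge {x, y} once, oriented from its smaller to
-- its larger end; this is the predicate it is filtered by.
orderedEdge : ∀ {n} → Adjacency n → Fin n → Fin n → Bool
orderedEdge adj x y = (toℕ x <ᵇ toℕ y) ∧ adj x y

orderedEdge-< : ∀ {n} {adj : Adjacency n} {a b} → orderedEdge adj a b ≡ true → toℕ a < toℕ b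
orderedEdge-< {adj = adj} {a} {b} ab = <ᵇ-sound {toℕ a} {toℕ b} (∧-conicalˡ (toℕ a <ᵇ toℕ b) (adj a b) ab)

orderedEdge-irrefl : ∀ {n} {adj : Adjacency n} {a} → ¬ (orderedEdge adj a a ≡ true)
orderedEdge-irrefl {adj = adj} {a} aa = <-irrefl refl (orderedEdge-< {adj = adj} {a} {a} aa)

orderedEdge-asym : ∀ {n} {adj : Adjacency n} {a b} → orderedEdge adj a b ≡ true → ¬ (orderedEdge adj b a ≡ true)
orderedEdge-asym {adj = adj} {a} {b} ab ba =
  <-asym (orderedEdge-< {adj = adj} {a} {b} ab) (orderedEdge-< {adj = adj} {b} {a} ba)

orientations : ∀ {n} {adj : Adjacency n} → IsSimple adj → ∀ a y →
  ⟦ orderedEdge adj a y ⟧ + ⟦ orderedEdge adj y a ⟧ ≡ ⟦ adj a y ⟧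
orientations {adj = adj} simple a y rewrite IsSimple.symmetric simple y a with <-cmp (toℕ a) (toℕ y)
... | tri< a<y _ y≮a rewrite <ᵇ-true a<y | <ᵇ-false y≮a = +-identityʳ ⟦ adj a y ⟧
... | tri> a≮y _ y<a rewrite <ᵇ-false a≮y | <ᵇ-true y<a = refl
... | tri≈ _ a≡y _ with toℕ-injective a≡y
...   | refl rewrite <ᵇ-false (<-irrefl {toℕ a} refl) | IsSimple.irreflexive simple a = refl

orient : ∀ {n} {adj : Adjacency n} → IsSimple adj → HasEdge adj →
  Σ (Fin n) λ x → Σ (Fin n) λ y → orderedEdge adj x y ≡ true
orient {adj = adj} simple (u , v , uv) with orderedEdge adj u v in u→v | orderedEdge adj v u in v→u | orientations simple u v
... | true  | _     | _     = u , v , u→v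
... | false | true  | _     = v , u , v→u
... | false | false | count with () ← trans count (cong ⟦_⟧ uv)

edgeSum : ∀ {n} → Adjacency n → (Fin n → Fin n → ℕ) → ℕ
edgeSum {n} adj w = ∑[ x < n ] ∑[ y < n ] (w x y * ⟦ orderedEdge adj x y ⟧)

edgeSum-cong : ∀ {n} (adj : Adjacency n) {w w′ : Fin n → Fin n → ℕ} →
  (∀ x y → orderedEdge adj x y ≡ true → w x y ≡ w′ x y) → edgeSum adj w ≡ edgeSum adj w′
edgeSum-cong adj {w} {w′} w≡w′ = sum-cong-≗ (λ x → sum-cong-≗ (λ y → pointwise x y))
  where
  pointwise : ∀ x y → w x y * ⟦ orderedEdge adj x y ⟧ ≡ w′ x y * ⟦ orderedEdge adj x y ⟧
  pointwise x y with orderedEdge adj x y in xy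
  ... | true  = cong (_* 1) (w≡w′ x y xy)
  ... | false = trans (*-zeroʳ (w x y)) (sym (*-zeroʳ (w′ x y)))

edgeSum-+ : ∀ {n} (adj : Adjacency n) (w w′ : Fin n → Fin n → ℕ) →
  edgeSum adj (λ x y → w x y + w′ x y) ≡ edgeSum adj w + edgeSum adj w′
edgeSum-+ {n} adj w w′ =
  trans (sum-cong-≗ (λ x → trans (sum-cong-≗ (λ y → *-distribʳ-+ (o x y) (w x y) (w′ x y)))
                                 (∑-distrib-+ (λ y → w x y * o x y) (λ y → w′ x y * o x y))))
        (∑-distrib-+ (λ x → ∑[ y < n ] (w x y * o x y)) (λ x → ∑[ y < n ] (w′ x y * o x y)))
  where
  o : Fin n → Fin n → ℕ
  o x y = ⟦ orderedEdge adj x y ⟧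

listSum-edges : ∀ {n} (adj : Adjacency n) (g : Fin n × Fin n → ℕ) →
  listSum g (edges adj) ≡ edgeSum adj (λ x y → g (x , y))
listSum-edges {n} adj g = begin
  listSum g (edges adj)
    ≡⟨ listSum-filterᵇ g (λ p → orderedEdge adj (proj₁ p) (proj₂ p)) (concatMap row (allFin n)) ⟩
  listSum weight (concatMap row (allFin n))
    ≡⟨ listSum-concatMap weight row (allFin n) ⟩
  listSum (λ x → listSum weight (row x)) (allFin n)
    ≡⟨ listSum-tabulate n (λ x → listSum weight (row x)) (λ x → x) ⟩
  ∑[ x < n ] listSum weight (row x)
    ≡⟨ sum-cong-≗ (λ x → trans (listSum-map weight (x ,_) (allFin n)) (listSum-tabulate n _ (λ y → y))) ⟩
  edgeSum adj (λ x y → g (x , y)) ∎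
  where
  open ≡-Reasoning
  row : Fin n → List (Fin n × Fin n)
  row x = map (x ,_) (allFin n)
  weight : Fin n × Fin n → ℕ
  weight p = g p * ⟦ orderedEdge adj (proj₁ p) (proj₂ p) ⟧

edges-oriented : ∀ {n} (adj : Adjacency n) (i : Fin (lineSize adj)) →
  orderedEdge adj (proj₁ (lookup (edges adj) i)) (proj₂ (lookup (edges adj) i)) ≡ true
edges-oriented {n} adj i = filterᵇ-lookup _ (concatMap (λ u → map (λ v → (u , v)) (allFin n)) (allFin n)) i

endpoint : ∀ {n} → Fin n → Fin n → Fin n → Bool
endpoint v x y = v == x ∨ v == y

-- An oriented edge has distinct ends, so it contains a vertex at most once.
endpoint-count : ∀ {n} {adj : Adjacency n} {a x y} → orderedEdge adj x y ≡ true →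
  ⟦ endpoint a x y ⟧ ≡ ⟦ a == x ⟧ + ⟦ a == y ⟧
endpoint-count {adj = adj} {a} {x} {y} xy =
  trans (cong (_+ ⟦ endpoint a x y ⟧) (sym (⟦⟧-false notBoth))) (⟦∧⟧+⟦∨⟧ (a == x) (a == y))
  where
  notBoth : ¬ ((a == x ∧ a == y) ≡ true)
  notBoth both = orderedEdge-irrefl {adj = adj} (subst (λ z → orderedEdge adj x z ≡ true) (sym x≡y) xy)
    where
    x≡y : x ≡ y
    x≡y = trans (sym (==-sound {a = a} (∧-conicalˡ (a == x) (a == y) both))) (==-sound {a = a} (∧-conicalʳ (a == x) (a == y) both))

edgeSum-from : ∀ {n} (adj : Adjacency n) a → edgeSum adj (λ x y → ⟦ a == x ⟧) ≡ ∑[ y < n ] ⟦ orderedEdge adj a y ⟧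
edgeSum-from {n} adj a = ∑∑-pick n n a (λ x y → ⟦ orderedEdge adj x y ⟧)

edgeSum-into : ∀ {n} (adj : Adjacency n) a → edgeSum adj (λ x y → ⟦ a == y ⟧) ≡ ∑[ x < n ] ⟦ orderedEdge adj x a ⟧
edgeSum-into {n} adj a = sum-cong-≗ (λ x → ∑-pick n a (λ y → ⟦ orderedEdge adj x y ⟧))

edgesAt : ∀ {n} {adj : Adjacency n} → IsSimple adj → ∀ a → edgeSum adj (λ x y → ⟦ endpoint a x y ⟧) ≡ degree adj a
edgesAt {n} {adj} simple a = begin
  edgeSum adj (λ x y → ⟦ endpoint a x y ⟧)
    ≡⟨ edgeSum-cong adj (λ x y xy → endpoint-count {adj = adj} {a} xy) ⟩
  edgeSum adj (λ x y → ⟦ a == x ⟧ + ⟦ a == y ⟧)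
    ≡⟨ edgeSum-+ adj (λ x y → ⟦ a == x ⟧) (λ x y → ⟦ a == y ⟧) ⟩
  edgeSum adj (λ x y → ⟦ a == x ⟧) + edgeSum adj (λ x y → ⟦ a == y ⟧)
    ≡⟨ cong₂ _+_ (edgeSum-from adj a) (edgeSum-into adj a) ⟩
  ∑[ y < n ] ⟦ orderedEdge adj a y ⟧ + ∑[ y < n ] ⟦ orderedEdge adj y a ⟧
    ≡⟨ sym (∑-distrib-+ (λ y → ⟦ orderedEdge adj a y ⟧) (λ y → ⟦ orderedEdge adj y a ⟧)) ⟩
  ∑[ y < n ] (⟦ orderedEdge adj a y ⟧ + ⟦ orderedEdge adj y a ⟧)
    ≡⟨ sum-cong-≗ (orientations simple a) ⟩
  ∑[ y < n ] ⟦ adj a y ⟧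
    ≡⟨ sym (degree-as-sum adj a) ⟩
  degree adj a ∎
  where open ≡-Reasoning

bothEnds : ∀ {n} {adj : Adjacency n} {a b x y} → orderedEdge adj x y ≡ true → orderedEdge adj a b ≡ true →
  (endpoint a x y ∧ endpoint b x y) ≡ true → a ≡ x × b ≡ y
bothEnds {adj = adj} {a} {b} {x} {y} xy ab both
  with ==-∨ {a = a} (∧-conicalˡ (endpoint a x y) (endpoint b x y) both)
     | ==-∨ {a = b} (∧-conicalʳ (endpoint a x y) (endpoint b x y) both)
... | inj₁ refl | inj₁ refl = ⊥-elim (orderedEdge-irrefl {adj = adj} ab)
... | inj₁ refl | inj₂ refl = refl , refl
... | inj₂ refl | inj₁ refl = ⊥-elim (orderedEdge-asym {adj = adj} xy ab)
... | inj₂ refl | inj₂ refl = ⊥-elim (orderedEdge-irrefl {adj = adj} ab)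

containsBoth : ∀ {n} {adj : Adjacency n} {a b x y} → orderedEdge adj x y ≡ true → orderedEdge adj a b ≡ true →
  ⟦ endpoint a x y ∧ endpoint b x y ⟧ ≡ ⟦ a == x ⟧ * ⟦ b == y ⟧
containsBoth {adj = adj} {a} {b} {x} {y} xy ab =
  trans (cong ⟦_⟧ (bool-ext forward backward)) (⟦∧⟧ (a == x) (b == y))
  where
  forward : (endpoint a x y ∧ endpoint b x y) ≡ true → (a == x ∧ b == y) ≡ true
  forward both with bothEnds {adj = adj} xy ab both
  ... | a≡x , b≡y = subst₂ (λ u v → (a == u ∧ b == v) ≡ true) a≡x b≡y (cong₂ _∧_ (==-refl a) (==-refl b))
  backward : (a == x ∧ b == y) ≡ true → (endpoint a x y ∧ endpoint b x y) ≡ true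
  backward same =
    subst₂ (λ u v → (endpoint a u v ∧ endpoint b u v) ≡ true)
      (==-sound {a = a} (∧-conicalˡ (a == x) (b == y) same)) (==-sound {a = b} (∧-conicalʳ (a == x) (b == y) same))
      (cong₂ _∧_ (cong (_∨ (a == b)) (==-refl a)) (trans (cong (b == a ∨_) (==-refl b)) (∨-zeroʳ (b == a))))

edgesThroughBoth : ∀ {n} {adj : Adjacency n} {a b} → orderedEdge adj a b ≡ true →
  edgeSum adj (λ x y → ⟦ endpoint a x y ∧ endpoint b x y ⟧) ≡ 1
edgesThroughBoth {n} {adj} {a} {b} ab = begin
  edgeSum adj (λ x y → ⟦ endpoint a x y ∧ endpoint b x y ⟧)
    ≡⟨ edgeSum-cong adj (λ x y xy → containsBoth {adj = adj} xy ab) ⟩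
  ∑[ x < n ] ∑[ y < n ] (⟦ a == x ⟧ * ⟦ b == y ⟧ * o x y)
    ≡⟨ sum-cong-≗ (λ x → sum-cong-≗ (λ y → *-assoc ⟦ a == x ⟧ ⟦ b == y ⟧ (o x y))) ⟩
  ∑[ x < n ] ∑[ y < n ] (⟦ a == x ⟧ * (⟦ b == y ⟧ * o x y))
    ≡⟨ ∑∑-pick n n a (λ x y → ⟦ b == y ⟧ * o x y) ⟩
  ∑[ y < n ] (⟦ b == y ⟧ * o a y)
    ≡⟨ ∑-pick n b (o a) ⟩
  ⟦ orderedEdge adj a b ⟧
    ≡⟨ cong ⟦_⟧ ab ⟩
  1 ∎
  where
  open ≡-Reasoning
  o : Fin n → Fin n → ℕ
  o x y = ⟦ orderedEdge adj x y ⟧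

-- Inclusion–exclusion: the edges meeting ab, counted together with ab once
-- more, number d(a) + d(b).
edgesMeeting : ∀ {n} {adj : Adjacency n} {a b} → IsSimple adj → orderedEdge adj a b ≡ true →
  1 + edgeSum adj (λ x y → ⟦ shareEndpoint (a , b) (x , y) ⟧) ≡ degree adj a + degree adj b
edgesMeeting {n} {adj} {a} {b} simple ab = begin
  1 + edgeSum adj (λ x y → ⟦ shareEndpoint (a , b) (x , y) ⟧)
    ≡⟨ cong₂ _+_ (sym (edgesThroughBoth {adj = adj} ab))
                 (edgeSum-cong adj (λ x y _ → cong ⟦_⟧ (sym (∨-assoc (a == x) (a == y) (endpoint b x y))))) ⟩
  edgeSum adj (λ x y → ⟦ A x y ∧ B x y ⟧) + edgeSum adj (λ x y → ⟦ A x y ∨ B x y ⟧)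
    ≡⟨ sym (edgeSum-+ adj (λ x y → ⟦ A x y ∧ B x y ⟧) (λ x y → ⟦ A x y ∨ B x y ⟧)) ⟩
  edgeSum adj (λ x y → ⟦ A x y ∧ B x y ⟧ + ⟦ A x y ∨ B x y ⟧)
    ≡⟨ edgeSum-cong adj (λ x y _ → ⟦∧⟧+⟦∨⟧ (A x y) (B x y)) ⟩
  edgeSum adj (λ x y → ⟦ A x y ⟧ + ⟦ B x y ⟧)
    ≡⟨ edgeSum-+ adj (λ x y → ⟦ A x y ⟧) (λ x y → ⟦ B x y ⟧) ⟩
  edgeSum adj (λ x y → ⟦ A x y ⟧) + edgeSum adj (λ x y → ⟦ B x y ⟧)
    ≡⟨ cong₂ _+_ (edgesAt simple a) (edgesAt simple b) ⟩
  degree adj a + degree adj b ∎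
  where
  open ≡-Reasoning
  A B : Fin n → Fin n → Bool
  A = endpoint a
  B = endpoint b

-- Vertex j counted once if it is i, or once if it is another vertex with s j:
-- this is just s j, provided s holds at i itself.  Applied to the line graph
-- with s = "meets edge i".
self-or-neighbour : ∀ {m} (i j : Fin m) (s : Fin m → Bool) → s i ≡ true →
  ⟦ i == j ⟧ * 1 + ⟦ not (i == j) ∧ s j ⟧ ≡ ⟦ s j ⟧
self-or-neighbour i j s si with i ≟ᶠ j
... | yes refl = cong ⟦_⟧ (sym si)
... | no _     = refl

shareEndpoint-refl : ∀ {n} (e : Fin n × Fin n) → shareEndpoint e e ≡ true
shareEndpoint-refl (a , b) = cong (_∨ (a == b ∨ b == a ∨ b == b)) (==-refl a)

lineDegree-count : ∀ {n} (adj : Adjacency n) (i : Fin (lineSize adj)) →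
  1 + degree (lineGraph adj) i ≡ listSum (λ f → ⟦ shareEndpoint (lookup (edges adj) i) f ⟧) (edges adj)
lineDegree-count {n} adj i = begin
  1 + degree (lineGraph adj) i
    ≡⟨ cong₂ _+_ (sym (∑-pick m i (λ _ → 1))) (degree-as-sum (lineGraph adj) i) ⟩
  ∑[ j < m ] (⟦ i == j ⟧ * 1) + ∑[ j < m ] ⟦ lineGraph adj i j ⟧
    ≡⟨ sym (∑-distrib-+ (λ j → ⟦ i == j ⟧ * 1) (λ j → ⟦ lineGraph adj i j ⟧)) ⟩
  ∑[ j < m ] (⟦ i == j ⟧ * 1 + ⟦ lineGraph adj i j ⟧)
    ≡⟨ sum-cong-≗ (λ j → self-or-neighbour i j meets (shareEndpoint-refl (lookup E i))) ⟩
  ∑[ j < m ] ⟦ meets j ⟧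
    ≡⟨ listSum-lookup (λ f → ⟦ shareEndpoint (lookup E i) f ⟧) E ⟩
  listSum (λ f → ⟦ shareEndpoint (lookup E i) f ⟧) E ∎
  where
  open ≡-Reasoning
  E : List (Fin n × Fin n)
  E = edges adj
  m : ℕ
  m = lineSize adj
  meets : Fin m → Bool
  meets j = shareEndpoint (lookup E i) (lookup E j)

lineDegree : ∀ {n} {adj : Adjacency n} → IsSimple adj → (i : Fin (lineSize adj)) →
  2 + degree (lineGraph adj) i ≡ degree adj (proj₁ (lookup (edges adj) i)) + degree adj (proj₂ (lookup (edges adj) i))
lineDegree {n} {adj} simple i = begin
  1 + (1 + degree (lineGraph adj) i)
    ≡⟨ cong (1 +_) (lineDegree-count adj i) ⟩
  1 + listSum (λ f → ⟦ shareEndpoint e f ⟧) (edges adj)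
    ≡⟨ cong (1 +_) (listSum-edges adj (λ f → ⟦ shareEndpoint e f ⟧)) ⟩
  1 + edgeSum adj (λ x y → ⟦ shareEndpoint e (x , y) ⟧)
    ≡⟨ edgesMeeting simple (edges-oriented adj i) ⟩
  degree adj (proj₁ e) + degree adj (proj₂ e) ∎
  where
  open ≡-Reasoning
  e : Fin n × Fin n
  e = lookup (edges adj) i

lineGraph-nonempty : ∀ {n} {adj : Adjacency n} → IsSimple adj → HasEdge adj → 0 < lineSize adj
lineGraph-nonempty {n} {adj} simple hasEdge with orient simple hasEdge
... | x , y , xy = begin
  1                                                 ≡⟨ cong (λ b → 1 * ⟦ b ⟧) (sym xy) ⟩
  1 * o x y                                         ≤⟨ term≤∑ n (λ y′ → 1 * o x y′) y ⟩
  ∑[ y′ < n ] (1 * o x y′)                          ≤⟨ term≤∑ n (λ x′ → ∑[ y′ < n ] (1 * o x′ y′)) x ⟩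
  edgeSum adj (λ _ _ → 1)                           ≡⟨ sym (listSum-edges adj (λ _ → 1)) ⟩
  listSum (λ _ → 1) (edges adj)                     ≡⟨ sym (length-as-listSum (edges adj)) ⟩
  lineSize adj                                      ∎
  where
  open ≤-Reasoning
  o : Fin n → Fin n → ℕ
  o x′ y′ = ⟦ orderedEdge adj x′ y′ ⟧

odd : ℕ → Bool
odd zero    = false
odd (suc n) = not (odd n)

odd-+ : ∀ m n → odd (m + n) ≡ odd m xor odd n
odd-+ zero    n = refl
odd-+ (suc m) n = trans (cong not (odd-+ m n)) (not-distribˡ-xor (odd m) (odd n))

odd-differByOne : ∀ m n → ∣ m - n ∣ ≡ 1 → odd m ≡ not (odd n)
odd-differByOne zero          (suc zero)    _     = refl
odd-differByOne (suc zero)    zero          _     = refl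
odd-differByOne (suc m)       (suc n)       m-n≡1 = cong not (odd-differByOne m n m-n≡1)
odd-differByOne zero          zero          ()
odd-differByOne zero          (suc (suc n)) ()
odd-differByOne (suc (suc m)) zero          ()

odd-+-differByOne : ∀ m n → ∣ m - n ∣ ≡ 1 → odd (m + n) ≡ true
odd-+-differByOne m n m-n≡1 = begin
  odd (m + n)            ≡⟨ odd-+ m n ⟩
  odd m xor odd n        ≡⟨ cong (_xor odd n) (odd-differByOne m n m-n≡1) ⟩
  not (odd n) xor odd n  ≡⟨ sym (not-distribˡ-xor (odd n) (odd n)) ⟩
  not (odd n xor odd n)  ≡⟨ cong not (xor-same (odd n)) ⟩
  true                   ∎
  where open ≡-Reasoning

odd⇒positive : ∀ {k} → odd k ≡ true → 0 < k
odd⇒positive {suc k} _ = z<s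

lineDegree-odd : ∀ {n} {adj : Adjacency n} → IsSimple adj → StepwiseIrregular adj →
  ∀ i → odd (degree (lineGraph adj) i) ≡ true
lineDegree-odd {n} {adj} simple stepwise i = begin
  odd (degree (lineGraph adj) i)          ≡⟨ sym (not-involutive (odd (degree (lineGraph adj) i))) ⟩
  odd (2 + degree (lineGraph adj) i)      ≡⟨ cong odd (lineDegree simple i) ⟩
  odd (degree adj a + degree adj b)       ≡⟨ odd-+-differByOne (degree adj a) (degree adj b) (stepwise a b ab) ⟩
  true                                    ∎
  where
  open ≡-Reasoning
  a b : Fin n
  a = proj₁ (lookup (edges adj) i)
  b = proj₂ (lookup (edges adj) i)
  ab : adj a b ≡ true
  ab = ∧-conicalʳ (toℕ a <ᵇ toℕ b) (adj a b) (edges-oriented adj i)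

-- The two ends of an edge of a stepwise irregular graph have degrees of
-- opposite parity; so a graph with a vertex and only odd degrees is not
-- stepwise irregular, an odd-degree vertex having a neighbour.
oddDegrees-notStepwiseIrregular : ∀ {m} (g : Adjacency m) → Fin m → (∀ v → odd (degree g v) ≡ true) →
  ¬ StepwiseIrregular g
oddDegrees-notStepwiseIrregular {m} g v allOdd stepwise =
  not-¬ (trans (allOdd v) (sym (allOdd w))) (odd-differByOne (degree g v) (degree g w) (stepwise v w vw))
  where
  w : Fin m
  w = lookup (filterᵇ (g v) (allFin m)) (fromℕ< (odd⇒positive (allOdd v)))
  vw : g v w ≡ true
  vw = filterᵇ-lookup (g v) (allFin m) (fromℕ< (odd⇒positive (allOdd v)))

mainTheorem17 : (n : ℕ) (adj : Adjacency n) → IsSimple adj → HasEdge adj → Connected adj → StepwiseIrregular adj → ¬ StepwiseIrregular (lineGraph adj)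
mainTheorem17 n adj simple hasEdge _ stepwise =
  oddDegrees-notStepwiseIrregular (lineGraph adj) (fromℕ< (lineGraph-nonempty simple hasEdge)) (lineDegree-odd simple stepwise)
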